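{- Let $(u_n)_{n\in\mathbb{N}}$ be the increasing sequence with $\{u_n:n\in\mathbb{N}\}=\{m\in\mathbb{N}: q_m=1\}$. Then $$\{u_{n+1}-u_n : n\in\mathbb{N}\}=\left\{\tfrac13\left(1+2\cdot4^k\right) : k\in\mathbb{N}\right\}.$$ Moreover, for each $k\in\mathbb{N}$, $u_{n+1}-u_n=\tfrac13(1+2\cdot4^k)$ if and only if $n=(2m+1)2^k-1$ for some $m\in\mathbb{N}$.
   Context: The Baum--Sweet sequence $(b_n)$ is defined by $b_0=1$ and, for $n\ge1$, $b_n=0$ if the binary expansion of $n$ contains a maximal block of $0$'s of odd length, $b_n=1$ otherwise. Let $D=\sum_{n\ge0}b''_nX^n\in\mathbb{F}_2[[X]]$ with $b''_0=0$, $b''_n=b_{n-1}$ ($n\ge1$), and let $Q=\sum q_nX^n$ be its composition inverse in $\mathbb{F}_2[[X]]$ (the unique series with $D(Q(X))=Q(D(X))=X$). -}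

module Defs where

open import Data.Nat using (ℕ; zero; suc; _+_; _∸_; _*_; _≟_)
open import Data.Nat.DivMod using (_/_; _%_)
open import Data.Bool using (Bool; true; false; not; _∧_; _∨_; _xor_; if_then_else_)
open import Data.List using (List; []; _∷_)
open import Relation.Nullary.Decidable using (does)

-- Binary digits of n, least significant first (no leading zeros); fuel = n suffices.
bitsFuel : ℕ → ℕ → List Bool
bitsFuel zero n = []
bitsFuel (suc f) zero = []
bitsFuel (suc f) (suc n) = does (suc n % 2 ≟ 1) ∷ bitsFuel f (suc n / 2)

bits : ℕ → List Bool
bits n = bitsFuel n n

-- hasOddZeroRun p xs : p = parity of the length of the current run of zeros;
-- returns true iff some maximal block of 0's has odd length.
hasOddZeroRun : Bool → List Bool → Bool
hasOddZeroRun p [] = p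
hasOddZeroRun p (false ∷ xs) = hasOddZeroRun (not p) xs
hasOddZeroRun p (true ∷ xs) = p ∨ hasOddZeroRun false xs

-- Baum–Sweet sequence (true = 1, false = 0)
baumSweet : ℕ → Bool
baumSweet zero = true
baumSweet (suc n) = not (hasOddZeroRun false (bits (suc n)))

-- Formal power series over F₂ = Bool (xor = +, ∧ = ·), as coefficient functions
Series : Set
Series = ℕ → Bool

D : Series
D zero = false
D (suc n) = baumSweet n

sumUpTo : ℕ → (ℕ → Bool) → Bool
sumUpTo zero f = f zero
sumUpTo (suc n) f = sumUpTo n f xor f (suc n)

mulS : Series → Series → Series
mulS f g n = sumUpTo n (λ i → f i ∧ g (n ∸ i))

oneS : Series
oneS zero = true
oneS (suc n) = false

XS : Series
XS (suc zero) = true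
XS _ = false

powS : Series → ℕ → Series
powS B zero = oneS
powS B (suc k) = mulS B (powS B k)

-- composition A(B(X)), for B with zero constant term: coefficient n is Σ_{k ≤ n} a_k [X^n] B^k
compS : Series → Series → Series
compS A B n = sumUpTo n (λ k → A k ∧ powS B k n)

gapValue : ℕ → ℕ
gapValue k = (1 + 2 * (4 Data.Nat.^ k)) / 3

module Submission where

-- Everything rests on one algebraic identity satisfied by D.
--  * Formal power series over F₂ (Bool with xor and ∧) form a commutative ring,
--    and for C with zero constant term, A ↦ A∘C is a ring homomorphism sending X to C.
--  * Frobenius: in characteristic 2, F²(2k) = F(k) and F²(2k+1) = 0.
--  * The Baum–Sweet recurrences b(2k+1) = b(k), b(4k+2) = 0, b(4k) = b(k) (k ≥ 1)
--    give the functional equation X⁴(D + D²) = X·D⁴.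
--  * Composing with Q (where D∘Q = X) turns it into Q⁴(X + X²) = Q·X⁴; by Frobenius
--    Q(4a) = Q(4a+3) = 0 and Q(4a+1) = Q(4a+2) = Q(a+1), while Q(1) = 1.
--  * Let ν(n) be the number of trailing 1-bits of n, g(k) = (1 + 2·4^k)/3 and
--    u(n) = 1 + Σ_{i<n} g(ν i).  Then u(2k) = 4(u k − 1) + 1 and u(2k+1) = 4(u k − 1) + 2,
--    so by the recurrences above Q(m) = 1 exactly when m is a value of u.
--  * Finally ν(n) = k iff n + 1 = (2m+1)·2^k, which describes the gaps u(n+1) − u(n) = g(ν n).

open import Defs
open import Data.Nat using (ℕ; zero; suc; _+_; _∸_; _*_; _^_; _<_; _≤_; z≤n; s≤s; _≟_; _≤?_)
open import Data.Nat.Properties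
open import Data.Nat.DivMod using (_/_; _%_; m/n≡1+[m∸n]/n; [m+n]%n≡m%n; m/n≤m; m*n/n≡m)
open import Data.Nat.Induction using (<-rec)
open import Data.Nat.Tactic.RingSolver using (solve-∀)
open import Data.Bool using (Bool; true; false; not; _∧_; _xor_; if_then_else_)
open import Data.Bool.Properties
  using (xor-same; xor-identityʳ; ∧-distribˡ-xor; ∧-distribʳ-xor; ∧-comm; ∧-zeroʳ; ∧-identityʳ; ∧-idem; ∧-assoc; xor-∧-commutativeRing)
open import Data.List using (_∷_)
open import Data.Maybe using (nothing)
open import Data.Product using (Σ; _×_; _,_; ∃; proj₁; proj₂)
open import Data.Sum using (_⊎_; inj₁; inj₂)
open import Data.Empty using (⊥-elim)
open import Function.Bundles using (_⇔_; mk⇔; Equivalence)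
open import Level using (0ℓ)
open import Relation.Nullary using (does; yes; no)
open import Relation.Nullary.Decidable using (dec-true; dec-false)
open import Relation.Binary.PropositionalEquality
import Tactic.RingSolver
import Tactic.RingSolver.Core.AlmostCommutativeRing as ACR

F₂ : ACR.AlmostCommutativeRing 0ℓ 0ℓ
F₂ = ACR.fromCommutativeRing xor-∧-commutativeRing (λ _ → nothing)

open Tactic.RingSolver using () renaming (solve-∀ to solve-F₂)

sum-cong≤ : ∀ n {f g : ℕ → Bool} → (∀ i → i ≤ n → f i ≡ g i) → sumUpTo n f ≡ sumUpTo n g
sum-cong≤ zero h = h 0 z≤n
sum-cong≤ (suc n) h = cong₂ _xor_ (sum-cong≤ n (λ i le → h i (m≤n⇒m≤1+n le))) (h (suc n) ≤-refl)

sum-cong : ∀ n {f g : ℕ → Bool} → (∀ i → f i ≡ g i) → sumUpTo n f ≡ sumUpTo n g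
sum-cong n h = sum-cong≤ n (λ i _ → h i)

sum-zero : ∀ n (f : ℕ → Bool) → (∀ i → i ≤ n → f i ≡ false) → sumUpTo n f ≡ false
sum-zero zero f h = h 0 z≤n
sum-zero (suc n) f h = cong₂ _xor_ (sum-zero n f (λ i le → h i (m≤n⇒m≤1+n le))) (h (suc n) ≤-refl)

sum-single : ∀ n j (f : ℕ → Bool) → j ≤ n → (∀ i → i ≤ n → i ≢ j → f i ≡ false) → sumUpTo n f ≡ f j
sum-single zero .zero f z≤n h = refl
sum-single (suc n) j f j≤ h with m≤n⇒m<n∨m≡n j≤
... | inj₁ (s≤s j≤n) =
  trans (cong₂ _xor_ (sum-single n j f j≤n (λ i le → h i (m≤n⇒m≤1+n le)))
                     (h (suc n) ≤-refl (λ e → <-irrefl (sym e) (s≤s j≤n))))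
        (xor-identityʳ (f j))
... | inj₂ refl = cong (_xor f (suc n)) (sum-zero n f (λ i le → h i (m≤n⇒m≤1+n le) (λ e → <-irrefl e (s≤s le))))

sum-extend : ∀ n m (f : ℕ → Bool) → n ≤ m → (∀ i → n < i → f i ≡ false) → sumUpTo m f ≡ sumUpTo n f
sum-extend n zero f z≤n h = refl
sum-extend n (suc m) f n≤ h with m≤n⇒m<n∨m≡n n≤
... | inj₁ (s≤s n≤m) = trans (cong₂ _xor_ (sum-extend n m f n≤m h) (h (suc m) (s≤s n≤m))) (xor-identityʳ _)
... | inj₂ refl = refl

xor-interchange : ∀ a b c d → (a xor b) xor (c xor d) ≡ (a xor c) xor (b xor d)
xor-interchange = solve-F₂ F₂

sum-xor : ∀ n (f g : ℕ → Bool) → sumUpTo n (λ i → f i xor g i) ≡ sumUpTo n f xor sumUpTo n g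
sum-xor zero f g = refl
sum-xor (suc n) f g = trans (cong (_xor (f (suc n) xor g (suc n))) (sum-xor n f g))
  (xor-interchange (sumUpTo n f) (sumUpTo n g) (f (suc n)) (g (suc n)))

sum-∧ˡ : ∀ n b (f : ℕ → Bool) → b ∧ sumUpTo n f ≡ sumUpTo n (λ i → b ∧ f i)
sum-∧ˡ zero b f = refl
sum-∧ˡ (suc n) b f = trans (∧-distribˡ-xor b (sumUpTo n f) (f (suc n))) (cong (_xor (b ∧ f (suc n))) (sum-∧ˡ n b f))

sum-∧ʳ : ∀ n b (f : ℕ → Bool) → sumUpTo n f ∧ b ≡ sumUpTo n (λ i → f i ∧ b)
sum-∧ʳ n b f = trans (∧-comm (sumUpTo n f) b) (trans (sum-∧ˡ n b f) (sum-cong n (λ i → ∧-comm b (f i))))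

sum-swap : ∀ n m (f : ℕ → ℕ → Bool) →
  sumUpTo n (λ i → sumUpTo m (λ j → f i j)) ≡ sumUpTo m (λ j → sumUpTo n (λ i → f i j))
sum-swap zero m f = refl
sum-swap (suc n) m f = trans (cong (_xor sumUpTo m (λ j → f (suc n) j)) (sum-swap n m f))
  (sym (sum-xor m (λ j → sumUpTo n (λ i → f i j)) (λ j → f (suc n) j)))

doubleSum : ℕ → (ℕ → ℕ → Bool) → Bool
doubleSum n M = sumUpTo n (λ i → sumUpTo n (λ j → M i j))

doubleSum-cong : ∀ n {M M' : ℕ → ℕ → Bool} → (∀ i j → M i j ≡ M' i j) → doubleSum n M ≡ doubleSum n M'
doubleSum-cong n h = sum-cong n (λ i → sum-cong n (h i))

doubleSum-∧ˡ : ∀ n b (M : ℕ → ℕ → Bool) → b ∧ doubleSum n M ≡ doubleSum n (λ i j → b ∧ M i j)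
doubleSum-∧ˡ n b M = trans (sum-∧ˡ n b _) (sum-cong n (λ i → sum-∧ˡ n b (M i)))

doubleSum-∧ʳ : ∀ n b (M : ℕ → ℕ → Bool) → doubleSum n M ∧ b ≡ doubleSum n (λ i j → M i j ∧ b)
doubleSum-∧ʳ n b M = trans (sum-∧ʳ n b _) (sum-cong n (λ i → sum-∧ʳ n b (M i)))

sum-∧-sum : ∀ n (f g : ℕ → Bool) → sumUpTo n f ∧ sumUpTo n g ≡ doubleSum n (λ i j → f i ∧ g j)
sum-∧-sum n f g = trans (sum-∧ʳ n _ f) (sum-cong n (λ i → sum-∧ˡ n (f i) g))

doubleSum-exchange : ∀ n (g : ℕ → ℕ → ℕ → ℕ → Bool) →
  doubleSum n (λ a b → doubleSum n (λ i j → g a b i j)) ≡ doubleSum n (λ i j → doubleSum n (λ a b → g a b i j))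
doubleSum-exchange n g =
  trans (sum-cong n (λ a → trans (sum-swap n n (λ b i → sumUpTo n (λ j → g a b i j)))
                                 (sum-cong n (λ i → sum-swap n n (λ b j → g a b i j)))))
  (trans (sum-swap n n (λ a i → sumUpTo n (λ j → sumUpTo n (λ b → g a b i j))))
         (sum-cong n (λ i → sum-swap n n (λ a j → sumUpTo n (λ b → g a b i j)))))

-- In characteristic 2 a symmetric double sum equals its diagonal.
doubleSum-symmetric : ∀ n (M : ℕ → ℕ → Bool) → (∀ i j → M i j ≡ M j i) →
  doubleSum n M ≡ sumUpTo n (λ i → M i i)
doubleSum-symmetric zero M s = refl
doubleSum-symmetric (suc n) M s = begin
    sumUpTo n (λ i → sumUpTo n (M i) xor M i (suc n)) xor (C xor d)
  ≡⟨ cong (_xor (C xor d)) (sum-xor n (λ i → sumUpTo n (M i)) (λ i → M i (suc n))) ⟩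
    (A xor B) xor (C xor d)
  ≡⟨ regroup A B C d ⟩
    A xor ((B xor C) xor d)
  ≡⟨ cong (λ z → A xor (z xor d)) B+C≡0 ⟩
    A xor (false xor d)
  ≡⟨ cong (_xor d) (doubleSum-symmetric n M s) ⟩
    sumUpTo n (λ i → M i i) xor d ∎
  where
    open ≡-Reasoning
    A = doubleSum n M
    B = sumUpTo n (λ i → M i (suc n))
    C = sumUpTo n (λ j → M (suc n) j)
    d = M (suc n) (suc n)
    regroup : ∀ a b c e → (a xor b) xor (c xor e) ≡ a xor ((b xor c) xor e)
    regroup = solve-F₂ F₂
    B+C≡0 : B xor C ≡ false
    B+C≡0 = trans (cong (B xor_) (sum-cong n (s (suc n)))) (xor-same B)

-- Kronecker delta, used to write products of series as unrestricted double sums.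
δ : ℕ → ℕ → Bool
δ m n = does (m ≟ n)

δ-refl : ∀ n → δ n n ≡ true
δ-refl n = dec-true (n ≟ n) refl

δ-≢ : ∀ {m n} → m ≢ n → δ m n ≡ false
δ-≢ {m} {n} = dec-false (m ≟ n)

sum-δ : ∀ n e (X : ℕ → Bool) → (n < e → X e ≡ false) → sumUpTo n (λ a → δ a e ∧ X a) ≡ X e
sum-δ n e X out with e ≤? n
... | yes e≤n = trans (sum-single n e _ e≤n (λ i _ i≢e → cong (_∧ X i) (δ-≢ {i} {e} i≢e)))
                      (cong (_∧ X e) (δ-refl e))
... | no e≰n = trans (sum-zero n _ (λ i i≤n → cong (_∧ X i) (δ-≢ {i} {e} (λ { refl → e≰n i≤n }))))
                     (sym (out (≰⇒> e≰n)))

-- The ring of formal power series over F₂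

_≈_ : Series → Series → Set
F ≈ G = ∀ n → F n ≡ G n

≈-sym : ∀ {F G} → F ≈ G → G ≈ F
≈-sym p n = sym (p n)

≈-trans : ∀ {F G H} → F ≈ G → G ≈ H → F ≈ H
≈-trans p q n = trans (p n) (q n)

addS : Series → Series → Series
addS F G n = F n xor G n

mulS-expand : ∀ F G {n} N → n ≤ N → mulS F G n ≡ doubleSum N (λ i j → δ n (i + j) ∧ (F i ∧ G j))
mulS-expand F G {n} N n≤N = trans (sum-cong≤ n row) (sym dropRows)
  where
    row : ∀ i → i ≤ n → F i ∧ G (n ∸ i) ≡ sumUpTo N (λ j → δ n (i + j) ∧ (F i ∧ G j))
    row i i≤n = sym (trans (sum-single N (n ∸ i) _ (≤-trans (m∸n≤m n i) n≤N) off) on)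
      where
        off : ∀ j → j ≤ N → j ≢ n ∸ i → δ n (i + j) ∧ (F i ∧ G j) ≡ false
        off j _ j≢ = cong (_∧ (F i ∧ G j)) (δ-≢ {n} {i + j} (λ e → j≢ (sym (trans (cong (_∸ i) e) (m+n∸m≡n i j)))))
        on : δ n (i + (n ∸ i)) ∧ (F i ∧ G (n ∸ i)) ≡ F i ∧ G (n ∸ i)
        on = cong (_∧ (F i ∧ G (n ∸ i))) (trans (cong (δ n) (m+[n∸m]≡n i≤n)) (δ-refl n))
    dropRows : doubleSum N (λ i j → δ n (i + j) ∧ (F i ∧ G j))
             ≡ sumUpTo n (λ i → sumUpTo N (λ j → δ n (i + j) ∧ (F i ∧ G j)))
    dropRows = sum-extend n N _ n≤N (λ i n<i → sum-zero N _ (λ j _ →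
      cong (_∧ (F i ∧ G j)) (δ-≢ {n} {i + j} (λ e → <-irrefl e (<-≤-trans n<i (m≤m+n i j))))))

mulS-cong : ∀ {F F' G G'} → F ≈ F' → G ≈ G' → mulS F G ≈ mulS F' G'
mulS-cong p q n = sum-cong n (λ i → cong₂ _∧_ (p i) (q (n ∸ i)))

mulS-comm : ∀ F G → mulS F G ≈ mulS G F
mulS-comm F G n = begin
    mulS F G n
  ≡⟨ mulS-expand F G n ≤-refl ⟩
    doubleSum n (λ i j → δ n (i + j) ∧ (F i ∧ G j))
  ≡⟨ sum-swap n n _ ⟩
    doubleSum n (λ j i → δ n (i + j) ∧ (F i ∧ G j))
  ≡⟨ doubleSum-cong n (λ j i → cong₂ _∧_ (cong (δ n) (+-comm i j)) (∧-comm (F i) (G j))) ⟩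
    doubleSum n (λ j i → δ n (j + i) ∧ (G j ∧ F i))
  ≡⟨ mulS-expand G F n ≤-refl ⟨
    mulS G F n ∎
  where open ≡-Reasoning

mulS-distribˡ : ∀ F G H → mulS F (addS G H) ≈ addS (mulS F G) (mulS F H)
mulS-distribˡ F G H n = trans (sum-cong n (λ i → ∧-distribˡ-xor (F i) (G (n ∸ i)) (H (n ∸ i)))) (sum-xor n _ _)

mulS-distribʳ : ∀ F G H → mulS (addS G H) F ≈ addS (mulS G F) (mulS H F)
mulS-distribʳ F G H n = trans (mulS-comm (addS G H) F n)
  (trans (mulS-distribˡ F G H n) (cong₂ _xor_ (mulS-comm F G n) (mulS-comm F H n)))

-- Both bracketings of F·G·H expand to Σ_{i,j,k ≤ n, i+j+k = n} F i G j H k.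
module Associativity (F G H : Series) (n : ℕ) where

  tripleTerm : ℕ → ℕ → ℕ → Bool
  tripleTerm i j k = δ n (i + (j + k)) ∧ (F i ∧ (G j ∧ H k))

  tripleSum : Bool
  tripleSum = sumUpTo n (λ i → doubleSum n (λ j k → tripleTerm i j k))

  leftTerm : ℕ → ℕ → ℕ → ℕ → Bool
  leftTerm a k i j = δ n (a + k) ∧ ((δ a (i + j) ∧ (F i ∧ G j)) ∧ H k)

  rightTerm : ℕ → ℕ → ℕ → ℕ → Bool
  rightTerm i b j k = δ n (i + b) ∧ (F i ∧ (δ b (j + k) ∧ (G j ∧ H k)))

  collapseLeft : ∀ i j k → sumUpTo n (λ a → leftTerm a k i j) ≡ tripleTerm i j k
  collapseLeft i j k =
    trans (sum-cong n (λ a → regroup (δ n (a + k)) (δ a (i + j)) (F i) (G j) (H k)))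
      (trans (sum-δ n (i + j) (λ a → δ n (a + k) ∧ (F i ∧ (G j ∧ H k))) out)
             (cong (λ z → δ n z ∧ (F i ∧ (G j ∧ H k))) (+-assoc i j k)))
    where
      regroup : ∀ x y f g h → x ∧ ((y ∧ (f ∧ g)) ∧ h) ≡ y ∧ (x ∧ (f ∧ (g ∧ h)))
      regroup = solve-F₂ F₂
      out : n < i + j → δ n (i + j + k) ∧ (F i ∧ (G j ∧ H k)) ≡ false
      out n<ij = cong (_∧ (F i ∧ (G j ∧ H k))) (δ-≢ {n} {i + j + k} (λ e → <-irrefl e (<-≤-trans n<ij (m≤m+n (i + j) k))))

  collapseRight : ∀ i j k → sumUpTo n (λ b → rightTerm i b j k) ≡ tripleTerm i j k
  collapseRight i j k =
    trans (sum-cong n (λ b → regroup (δ n (i + b)) (F i) (δ b (j + k)) (G j) (H k)))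
          (sum-δ n (j + k) (λ b → δ n (i + b) ∧ (F i ∧ (G j ∧ H k))) out)
    where
      regroup : ∀ x f y g h → x ∧ (f ∧ (y ∧ (g ∧ h))) ≡ y ∧ (x ∧ (f ∧ (g ∧ h)))
      regroup = solve-F₂ F₂
      out : n < j + k → δ n (i + (j + k)) ∧ (F i ∧ (G j ∧ H k)) ≡ false
      out n<jk = cong (_∧ (F i ∧ (G j ∧ H k))) (δ-≢ {n} {i + (j + k)} (λ e → <-irrefl e (<-≤-trans n<jk (m≤n+m (j + k) i))))

  left : mulS (mulS F G) H n ≡ tripleSum
  left = begin
      mulS (mulS F G) H n
    ≡⟨ mulS-expand (mulS F G) H n ≤-refl ⟩
      doubleSum n (λ a k → δ n (a + k) ∧ (mulS F G a ∧ H k))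
    ≡⟨ sum-cong≤ n (λ a a≤n → sum-cong n (λ k → expandInner a a≤n k)) ⟩
      doubleSum n (λ a k → doubleSum n (leftTerm a k))
    ≡⟨ doubleSum-exchange n leftTerm ⟩
      doubleSum n (λ i j → doubleSum n (λ a k → leftTerm a k i j))
    ≡⟨ doubleSum-cong n (λ i j → sum-swap n n (λ a k → leftTerm a k i j)) ⟩
      doubleSum n (λ i j → doubleSum n (λ k a → leftTerm a k i j))
    ≡⟨ doubleSum-cong n (λ i j → sum-cong n (collapseLeft i j)) ⟩
      tripleSum ∎
    where
      open ≡-Reasoning
      expandInner : ∀ a → a ≤ n → ∀ k → δ n (a + k) ∧ (mulS F G a ∧ H k) ≡ doubleSum n (leftTerm a k)
      expandInner a a≤n k =
        trans (cong (λ z → δ n (a + k) ∧ (z ∧ H k)) (mulS-expand F G n a≤n))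
          (trans (cong (δ n (a + k) ∧_) (doubleSum-∧ʳ n (H k) _)) (doubleSum-∧ˡ n (δ n (a + k)) _))

  right : mulS F (mulS G H) n ≡ tripleSum
  right = begin
      mulS F (mulS G H) n
    ≡⟨ mulS-expand F (mulS G H) n ≤-refl ⟩
      doubleSum n (λ i b → δ n (i + b) ∧ (F i ∧ mulS G H b))
    ≡⟨ sum-cong n (λ i → sum-cong≤ n (λ b b≤n → expandInner i b b≤n)) ⟩
      doubleSum n (λ i b → doubleSum n (rightTerm i b))
    ≡⟨ sum-cong n (λ i → sum-swap n n (λ b j → sumUpTo n (rightTerm i b j))) ⟩
      sumUpTo n (λ i → doubleSum n (λ j b → sumUpTo n (rightTerm i b j)))
    ≡⟨ sum-cong n (λ i → sum-cong n (λ j → sum-swap n n (λ b k → rightTerm i b j k))) ⟩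
      sumUpTo n (λ i → doubleSum n (λ j k → sumUpTo n (λ b → rightTerm i b j k)))
    ≡⟨ sum-cong n (λ i → doubleSum-cong n (collapseRight i)) ⟩
      tripleSum ∎
    where
      open ≡-Reasoning
      expandInner : ∀ i b → b ≤ n → δ n (i + b) ∧ (F i ∧ mulS G H b) ≡ doubleSum n (rightTerm i b)
      expandInner i b b≤n =
        trans (cong (λ z → δ n (i + b) ∧ (F i ∧ z)) (mulS-expand G H n b≤n))
          (trans (cong (δ n (i + b) ∧_) (doubleSum-∧ˡ n (F i) _)) (doubleSum-∧ˡ n (δ n (i + b)) _))

mulS-assoc : ∀ F G H → mulS (mulS F G) H ≈ mulS F (mulS G H)
mulS-assoc F G H n = trans (Associativity.left F G H n) (sym (Associativity.right F G H n))

mulS-oneʳ : ∀ F → mulS F oneS ≈ F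
mulS-oneʳ F n = trans (sum-single n n (λ i → F i ∧ oneS (n ∸ i)) ≤-refl off)
                      (trans (cong (λ z → F n ∧ oneS z) (n∸n≡0 n)) (∧-identityʳ (F n)))
  where
    oneS-suc : ∀ m → m ≢ 0 → oneS m ≡ false
    oneS-suc zero m≢0 = ⊥-elim (m≢0 refl)
    oneS-suc (suc m) _ = refl
    off : ∀ i → i ≤ n → i ≢ n → F i ∧ oneS (n ∸ i) ≡ false
    off i i≤n i≢n = trans (cong (F i ∧_) (oneS-suc (n ∸ i) (λ e → i≢n (≤-antisym i≤n (m∸n≡0⇒m≤n e))))) (∧-zeroʳ (F i))

mulS-oneˡ : ∀ F → mulS oneS F ≈ F
mulS-oneˡ F = ≈-trans (mulS-comm oneS F) (mulS-oneʳ F)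

powS-add : ∀ C i j → powS C (i + j) ≈ mulS (powS C i) (powS C j)
powS-add C zero j = ≈-sym (mulS-oneˡ (powS C j))
powS-add C (suc i) j = ≈-trans (mulS-cong {C} {C} (λ _ → refl) (powS-add C i j))
                               (≈-sym (mulS-assoc C (powS C i) (powS C j)))

-- Composition A ↦ A∘C, for C with zero constant term, is a ring homomorphism

module Composition (C : Series) (C0 : C 0 ≡ false) where

  powS-low : ∀ k n → n < k → powS C k n ≡ false
  powS-low (suc k) n (s≤s n≤k) = sum-zero n _ term
    where
      term : ∀ i → i ≤ n → C i ∧ powS C k (n ∸ i) ≡ false
      term zero _ = cong (_∧ powS C k n) C0
      term (suc i) i<n = trans (cong (C (suc i) ∧_)
        (powS-low k (n ∸ suc i) (<-≤-trans (∸-monoʳ-< {n} {suc i} {0} (s≤s z≤n) i<n) n≤k))) (∧-zeroʳ _)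

  compS-extend : ∀ A {n} N → n ≤ N → sumUpTo N (λ k → A k ∧ powS C k n) ≡ compS A C n
  compS-extend A {n} N n≤N =
    sum-extend n N _ n≤N (λ k n<k → trans (cong (A k ∧_) (powS-low k n n<k)) (∧-zeroʳ (A k)))

  compS-cong : ∀ {A A'} → A ≈ A' → compS A C ≈ compS A' C
  compS-cong p n = sum-cong n (λ k → cong (_∧ powS C k n) (p k))

  compS-add : ∀ A B → compS (addS A B) C ≈ addS (compS A C) (compS B C)
  compS-add A B n = trans (sum-cong n (λ k → ∧-distribʳ-xor (powS C k n) (A k) (B k))) (sum-xor n _ _)

  compS-X : compS XS C ≈ C
  compS-X n = trans (sym (compS-extend XS (suc n) (n≤1+n n)))
                    (trans (sum-single (suc n) 1 _ (s≤s z≤n) (λ i _ → off i)) (mulS-oneʳ C n))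
    where
      off : ∀ i → i ≢ 1 → XS i ∧ powS C i n ≡ false
      off zero _ = refl
      off (suc zero) i≢1 = ⊥-elim (i≢1 refl)
      off (suc (suc i)) _ = refl

  -- Both (A·B)∘C and (A∘C)·(B∘C) expand to Σ_{i,j ≤ n} A i B j [X^n] C^(i+j).
  module Multiplicativity (A B : Series) (n : ℕ) where

    productTerm : ℕ → ℕ → Bool
    productTerm i j = (A i ∧ B j) ∧ powS C (i + j) n

    left : compS (mulS A B) C n ≡ doubleSum n productTerm
    left = begin
        sumUpTo n (λ k → mulS A B k ∧ powS C k n)
      ≡⟨ sum-cong≤ n (λ k k≤n → trans (cong (_∧ powS C k n) (mulS-expand A B n k≤n)) (doubleSum-∧ʳ n _ _)) ⟩
        sumUpTo n (λ k → doubleSum n (λ i j → (δ k (i + j) ∧ (A i ∧ B j)) ∧ powS C k n))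
      ≡⟨ sum-swap n n _ ⟩
        sumUpTo n (λ i → sumUpTo n (λ k → sumUpTo n (λ j → (δ k (i + j) ∧ (A i ∧ B j)) ∧ powS C k n)))
      ≡⟨ sum-cong n (λ i → sum-swap n n _) ⟩
        doubleSum n (λ i j → sumUpTo n (λ k → (δ k (i + j) ∧ (A i ∧ B j)) ∧ powS C k n))
      ≡⟨ doubleSum-cong n (λ i j → trans (sum-cong n (λ k → ∧-assoc (δ k (i + j)) _ _))
                                         (sum-δ n (i + j) _ (out i j))) ⟩
        doubleSum n productTerm ∎
      where
        open ≡-Reasoning
        out : ∀ i j → n < i + j → productTerm i j ≡ false
        out i j n<ij = trans (cong ((A i ∧ B j) ∧_) (powS-low (i + j) n n<ij)) (∧-zeroʳ _)

    pairTerm : ℕ → ℕ → ℕ → ℕ → Bool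
    pairTerm a b i j = δ n (a + b) ∧ ((A i ∧ powS C i a) ∧ (B j ∧ powS C j b))

    right : mulS (compS A C) (compS B C) n ≡ doubleSum n productTerm
    right = begin
        mulS (compS A C) (compS B C) n
      ≡⟨ mulS-expand (compS A C) (compS B C) n ≤-refl ⟩
        doubleSum n (λ a b → δ n (a + b) ∧ (compS A C a ∧ compS B C b))
      ≡⟨ sum-cong≤ n (λ a a≤n → sum-cong≤ n (λ b b≤n → expandFactors a b a≤n b≤n)) ⟩
        doubleSum n (λ a b → doubleSum n (pairTerm a b))
      ≡⟨ doubleSum-exchange n pairTerm ⟩
        doubleSum n (λ i j → doubleSum n (λ a b → pairTerm a b i j))
      ≡⟨ doubleSum-cong n powerProduct ⟩
        doubleSum n productTerm ∎
      where
        open ≡-Reasoning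
        expandFactors : ∀ a b → a ≤ n → b ≤ n →
          δ n (a + b) ∧ (compS A C a ∧ compS B C b) ≡ doubleSum n (pairTerm a b)
        expandFactors a b a≤n b≤n =
          trans (cong₂ (λ x y → δ n (a + b) ∧ (x ∧ y)) (sym (compS-extend A n a≤n)) (sym (compS-extend B n b≤n)))
            (trans (cong (δ n (a + b) ∧_) (sum-∧-sum n _ _)) (doubleSum-∧ˡ n (δ n (a + b)) _))
        regroup : ∀ e a p b q → e ∧ ((a ∧ p) ∧ (b ∧ q)) ≡ (a ∧ b) ∧ (e ∧ (p ∧ q))
        regroup = solve-F₂ F₂
        -- the inner sum over a, b is the coefficient of C^i·C^j = C^(i+j)
        powerProduct : ∀ i j → doubleSum n (λ a b → pairTerm a b i j) ≡ productTerm i j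
        powerProduct i j =
          trans (doubleSum-cong n (λ a b → regroup (δ n (a + b)) (A i) (powS C i a) (B j) (powS C j b)))
            (trans (sym (doubleSum-∧ˡ n (A i ∧ B j) _))
              (cong ((A i ∧ B j) ∧_) (sym (trans (powS-add C i j n) (mulS-expand (powS C i) (powS C j) n ≤-refl)))))

  compS-mul : ∀ A B → compS (mulS A B) C ≈ mulS (compS A C) (compS B C)
  compS-mul A B n = trans (Multiplicativity.left A B n) (sym (Multiplicativity.right A B n))

shiftS : Series → Series
shiftS F zero = false
shiftS F (suc n) = F n

mulS-X : ∀ F → mulS XS F ≈ shiftS F
mulS-X F zero = refl
mulS-X F (suc n) = sum-single (suc n) 1 _ (s≤s z≤n) (λ i _ → off i)
  where
    off : ∀ i → i ≢ 1 → XS i ∧ F (suc n ∸ i) ≡ false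
    off zero _ = refl
    off (suc zero) i≢1 = ⊥-elim (i≢1 refl)
    off (suc (suc i)) _ = refl

X² : Series
X² = mulS XS XS

X⁴ : Series
X⁴ = mulS X² X²

mulS-X⁴ : ∀ G → mulS X⁴ G ≈ shiftS (shiftS (shiftS (shiftS G)))
mulS-X⁴ G = ≈-trans (mulS-assoc X² X² G)
  (≈-trans (mulS-assoc XS XS (mulS X² G))
  (≈-trans (mulS-X (mulS XS (mulS X² G)))
  (≈-trans (shift-cong (mulS-X (mulS X² G)))
  (≈-trans (shift-cong (shift-cong (mulS-assoc XS XS G)))
  (≈-trans (shift-cong (shift-cong (mulS-X (mulS XS G))))
           (shift-cong (shift-cong (shift-cong (mulS-X G)))))))))
  where
    shift-cong : ∀ {F F'} → F ≈ F' → shiftS F ≈ shiftS F'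
    shift-cong p zero = refl
    shift-cong p (suc n) = p n

double-suc : ∀ k → suc (suc (k + k)) ≡ suc k + suc k
double-suc k = cong suc (sym (+-suc k k))

double≡2* : ∀ k → k + k ≡ 2 * k
double≡2* k = cong (k +_) (sym (+-identityʳ k))

double-injective : ∀ i k → i + i ≡ k + k → i ≡ k
double-injective i k e = *-cancelˡ-≡ i k 2 (trans (sym (double≡2* i)) (trans e (double≡2* k)))

double≢odd : ∀ i k → i + i ≢ suc (k + k)
double≢odd i k e = even≢odd i k (trans (sym (double≡2* i)) (trans e (cong suc (double≡2* k))))

-- In characteristic 2, F² = Σ F(k) X^(2k): the cross terms cancel in pairs.
square-diagonal : ∀ F n → mulS F F n ≡ sumUpTo n (λ i → δ n (i + i) ∧ F i)
square-diagonal F n = begin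
    mulS F F n
  ≡⟨ mulS-expand F F n ≤-refl ⟩
    doubleSum n (λ i j → δ n (i + j) ∧ (F i ∧ F j))
  ≡⟨ doubleSum-symmetric n _ (λ i j → cong₂ _∧_ (cong (δ n) (+-comm i j)) (∧-comm (F i) (F j))) ⟩
    sumUpTo n (λ i → δ n (i + i) ∧ (F i ∧ F i))
  ≡⟨ sum-cong n (λ i → cong (δ n (i + i) ∧_) (∧-idem (F i))) ⟩
    sumUpTo n (λ i → δ n (i + i) ∧ F i) ∎
  where open ≡-Reasoning

square-even : ∀ F k → mulS F F (k + k) ≡ F k
square-even F k = trans (square-diagonal F (k + k)) (trans
  (sum-single (k + k) k _ (m≤m+n k k) (λ i _ i≢k → cong (_∧ F i) (δ-≢ {k + k} {i + i} (λ e → i≢k (sym (double-injective k i e))))))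
  (cong (_∧ F k) (δ-refl (k + k))))

square-odd : ∀ F k → mulS F F (suc (k + k)) ≡ false
square-odd F k = trans (square-diagonal F (suc (k + k)))
  (sum-zero (suc (k + k)) _ (λ i _ → cong (_∧ F i) (δ-≢ {suc (k + k)} {i + i} (λ e → double≢odd i k (sym e)))))

-- Applying Frobenius twice: F⁴ = Σ F(k) X^(4k).
quad : ℕ → ℕ
quad a = (a + a) + (a + a)

quad-suc : ∀ a → suc (suc (suc (suc (quad a)))) ≡ quad (suc a)
quad-suc = expanded
  where
    expanded : ∀ a → suc (suc (suc (suc ((a + a) + (a + a))))) ≡ (suc a + suc a) + (suc a + suc a)
    expanded = solve-∀

data Residue4 : ℕ → Set where
  r0 : ∀ a → Residue4 (quad a)
  r1 : ∀ a → Residue4 (suc (quad a))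
  r2 : ∀ a → Residue4 (suc (suc (quad a)))
  r3 : ∀ a → Residue4 (suc (suc (suc (quad a))))

residue4 : ∀ m → Residue4 m
residue4 zero = r0 0
residue4 (suc m) with residue4 m
... | r0 a = r1 a
... | r1 a = r2 a
... | r2 a = r3 a
... | r3 a = subst Residue4 (sym (quad-suc a)) (r0 (suc a))

module FourthPower (F : Series) where

  F² : Series
  F² = mulS F F

  F⁴ : Series
  F⁴ = mulS F² F²

  at-quad : ∀ a → F⁴ (quad a) ≡ F a
  at-quad a = trans (square-even F² (a + a)) (square-even F a)

  at-quad+1 : ∀ a → F⁴ (suc (quad a)) ≡ false
  at-quad+1 a = square-odd F² (a + a)

  at-quad+2 : ∀ a → F⁴ (suc (suc (quad a))) ≡ false
  at-quad+2 a = trans (cong F⁴ (double-suc (a + a))) (trans (square-even F² (suc (a + a))) (square-odd F a))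

  at-quad+3 : ∀ a → F⁴ (suc (suc (suc (quad a)))) ≡ false
  at-quad+3 a = trans (cong (λ z → F⁴ (suc z)) (double-suc (a + a))) (square-odd F² (suc (a + a)))

  at-quad+4 : ∀ a → F⁴ (suc (suc (suc (suc (quad a))))) ≡ F (suc a)
  at-quad+4 a = trans (cong F⁴ (quad-suc a)) (at-quad (suc a))

  at-quad+5 : ∀ a → F⁴ (suc (suc (suc (suc (suc (quad a)))))) ≡ false
  at-quad+5 a = trans (cong (λ z → F⁴ (suc z)) (quad-suc a)) (at-quad+1 (suc a))

  at-quad+6 : ∀ a → F⁴ (suc (suc (suc (suc (suc (suc (quad a))))))) ≡ false
  at-quad+6 a = trans (cong (λ z → F⁴ (suc (suc z))) (quad-suc a)) (at-quad+2 (suc a))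

-- Binary expansions and the Baum–Sweet recurrences

half-step : ∀ n → suc (suc n) / 2 ≡ suc (n / 2)
half-step n = m/n≡1+[m∸n]/n {suc (suc n)} {2} (s≤s (s≤s z≤n))

parity-step : ∀ n → suc (suc n) % 2 ≡ n % 2
parity-step n = trans (cong (_% 2) (+-comm 2 n)) ([m+n]%n≡m%n n 2)

double-half : ∀ k → (k + k) / 2 ≡ k
double-half zero = refl
double-half (suc k) = trans (cong (_/ 2) (sym (double-suc k))) (trans (half-step (k + k)) (cong suc (double-half k)))

odd-half : ∀ k → suc (k + k) / 2 ≡ k
odd-half zero = refl
odd-half (suc k) = trans (cong (λ z → suc z / 2) (sym (double-suc k))) (trans (half-step (suc (k + k))) (cong suc (odd-half k)))

double-parity : ∀ k → (k + k) % 2 ≡ 0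
double-parity zero = refl
double-parity (suc k) = trans (cong (_% 2) (sym (double-suc k))) (trans (parity-step (k + k)) (double-parity k))

odd-parity : ∀ k → suc (k + k) % 2 ≡ 1
odd-parity zero = refl
odd-parity (suc k) = trans (cong (λ z → suc z % 2) (sym (double-suc k))) (trans (parity-step (suc (k + k))) (odd-parity k))

half-≤ : ∀ n → suc n / 2 ≤ n
half-≤ zero = z≤n
half-≤ (suc n) = subst (_≤ suc n) (sym (half-step n)) (s≤s (m/n≤m n 2))

bitsFuel-stable : ∀ f g n → n ≤ f → n ≤ g → bitsFuel f n ≡ bitsFuel g n
bitsFuel-stable zero zero .zero z≤n z≤n = refl
bitsFuel-stable zero (suc g) .zero z≤n z≤n = refl
bitsFuel-stable (suc f) zero .zero z≤n z≤n = refl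
bitsFuel-stable (suc f) (suc g) zero _ _ = refl
bitsFuel-stable (suc f) (suc g) (suc n) (s≤s n≤f) (s≤s n≤g) =
  cong (_ ∷_) (bitsFuel-stable f g (suc n / 2) (≤-trans (half-≤ n) n≤f) (≤-trans (half-≤ n) n≤g))

bits-odd : ∀ k → bits (suc (k + k)) ≡ true ∷ bits k
bits-odd k = cong₂ _∷_ (cong (λ z → does (z ≟ 1)) (odd-parity k))
  (trans (cong (bitsFuel (k + k)) (odd-half k)) (bitsFuel-stable (k + k) k k (m≤m+n k k) ≤-refl))

bits-even : ∀ k → bits (suc (suc (k + k))) ≡ false ∷ bits (suc k)
bits-even k = cong₂ _∷_ (cong (λ z → does (z ≟ 1)) (trans (parity-step (k + k)) (double-parity k)))
  (trans (cong (bitsFuel (suc (k + k))) (trans (half-step (k + k)) (cong suc (double-half k))))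
         (bitsFuel-stable (suc (k + k)) (suc k) (suc k) (s≤s (m≤m+n k k)) ≤-refl))

-- b(2k+1) = b(k): a trailing 1 starts no block of zeros.
baumSweet-odd : ∀ k → baumSweet (suc (k + k)) ≡ baumSweet k
baumSweet-odd zero = refl
baumSweet-odd (suc k) = cong (λ l → not (hasOddZeroRun false l)) (bits-odd (suc k))

-- b(4k+2) = 0: the expansion ends in 10, a block of zeros of length 1.
baumSweet-4k+2 : ∀ k → baumSweet (suc (suc (quad k))) ≡ false
baumSweet-4k+2 k = cong (λ l → not (hasOddZeroRun false l)) (trans (bits-even (k + k)) (cong (false ∷_) (bits-odd k)))

-- b(4k) = b(k): two trailing zeros do not change the parity of the last block.
baumSweet-quad : ∀ k → baumSweet (quad k) ≡ baumSweet k
baumSweet-quad zero = refl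
baumSweet-quad (suc j) = trans (cong baumSweet (sym (quad-suc j)))
  (cong (λ l → not (hasOddZeroRun false l))
        (trans (cong bits (cong (λ z → suc (suc z)) (double-suc (j + j))))
               (trans (bits-even (suc (j + j))) (cong (false ∷_) (bits-even j)))))

D-quad : ∀ a → D (quad a) ≡ D (a + a)
D-quad zero = refl
D-quad (suc j) = trans (cong D (sym (quad-suc j)))
  (trans (cong (λ z → baumSweet (suc z)) (double-suc (j + j)))
  (trans (baumSweet-odd (suc (j + j)))
         (sym (cong baumSweet (+-suc j j)))))

-- The functional equation X⁴(D + D²) = X·D⁴

open FourthPower D using () renaming (F² to D²; F⁴ to D⁴)

functional-coefficient : ∀ m → D m xor D² m ≡ D⁴ (3 + m)
functional-coefficient m with residue4 m
... | r0 a = trans (cong₂ _xor_ (D-quad a) (square-even D (a + a)))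
                   (trans (xor-same (D (a + a))) (sym (FourthPower.at-quad+3 D a)))
... | r1 a = trans (cong₂ _xor_ (baumSweet-quad a) (square-odd D (a + a)))
                   (trans (xor-identityʳ _) (sym (FourthPower.at-quad+4 D a)))
... | r2 a = trans (cong₂ _xor_ (baumSweet-odd (a + a)) (trans (cong D² (double-suc (a + a))) (square-even D (suc (a + a)))))
                   (trans (xor-same (baumSweet (a + a))) (sym (FourthPower.at-quad+5 D a)))
... | r3 a = trans (cong₂ _xor_ (baumSweet-4k+2 a) (trans (cong (λ z → D² (suc z)) (double-suc (a + a))) (square-odd D (suc (a + a)))))
                   (sym (FourthPower.at-quad+6 D a))

functional-equation : mulS X⁴ (addS D D²) ≈ mulS XS D⁴
functional-equation = ≈-trans (mulS-X⁴ (addS D D²)) (≈-trans shifted (≈-sym (mulS-X D⁴)))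
  where
    shifted : shiftS (shiftS (shiftS (shiftS (addS D D²)))) ≈ shiftS D⁴
    shifted 0 = refl
    shifted 1 = sym (FourthPower.at-quad D 0)
    shifted 2 = sym (FourthPower.at-quad+1 D 0)
    shifted 3 = sym (FourthPower.at-quad+2 D 0)
    shifted (suc (suc (suc (suc m)))) = functional-coefficient m

-- Coefficient recurrences for the composition inverse Q

module InverseCoefficients (Q : Series) (Q0 : Q 0 ≡ false) (D∘Q≈X : ∀ n → compS D Q n ≡ XS n) where

  open Composition Q Q0
  open FourthPower Q using () renaming (F⁴ to Q⁴)

  compS-square : ∀ {F G} → compS F Q ≈ G → compS (mulS F F) Q ≈ mulS G G
  compS-square p = ≈-trans (compS-mul _ _) (mulS-cong p p)

  -- Substituting Q into the functional equation of D gives Q⁴·(X + X²) = Q·X⁴.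
  composed-equation : mulS Q⁴ (addS XS X²) ≈ mulS Q X⁴
  composed-equation = ≈-trans (≈-sym left) (≈-trans (compS-cong functional-equation) right)
    where
      X⁴∘Q : compS X⁴ Q ≈ Q⁴
      X⁴∘Q = compS-square (compS-square compS-X)
      D²∘Q : compS D² Q ≈ X²
      D²∘Q = compS-square D∘Q≈X
      left : compS (mulS X⁴ (addS D D²)) Q ≈ mulS Q⁴ (addS XS X²)
      left = ≈-trans (compS-mul X⁴ (addS D D²))
               (mulS-cong X⁴∘Q (≈-trans (compS-add D D²) (λ n → cong₂ _xor_ (D∘Q≈X n) (D²∘Q n))))
      right : compS (mulS XS D⁴) Q ≈ mulS Q X⁴
      right = ≈-trans (compS-mul XS D⁴) (mulS-cong compS-X (compS-square D²∘Q))

  -- Reading off the coefficient of X^(n+4).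
  recurrence : ∀ n → Q n ≡ Q⁴ (3 + n) xor Q⁴ (2 + n)
  recurrence n = begin
      Q n
    ≡⟨ mulS-X⁴ Q N ⟨
      mulS X⁴ Q N
    ≡⟨ mulS-comm X⁴ Q N ⟩
      mulS Q X⁴ N
    ≡⟨ composed-equation N ⟨
      mulS Q⁴ (addS XS X²) N
    ≡⟨ mulS-comm Q⁴ (addS XS X²) N ⟩
      mulS (addS XS X²) Q⁴ N
    ≡⟨ mulS-distribʳ Q⁴ XS X² N ⟩
      mulS XS Q⁴ N xor mulS X² Q⁴ N
    ≡⟨ cong₂ _xor_ (mulS-X Q⁴ N) (trans (mulS-assoc XS XS Q⁴ N) (trans (mulS-X (mulS XS Q⁴) N) (mulS-X Q⁴ (3 + n)))) ⟩
      Q⁴ (3 + n) xor Q⁴ (2 + n) ∎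
    where
      open ≡-Reasoning
      N = 4 + n

  -- [X¹] D∘Q = D(1)·Q(1) = Q(1), since D(1) = b(0) = 1.
  Q-one : Q 1 ≡ true
  Q-one = trans (sym (cong₂ _xor_ (∧-zeroʳ (Q 0)) (∧-identityʳ (Q 1)))) (D∘Q≈X 1)

  Q-quad : ∀ a → Q (quad a) ≡ false
  Q-quad a = trans (recurrence (quad a)) (cong₂ _xor_ (FourthPower.at-quad+3 Q a) (FourthPower.at-quad+2 Q a))

  Q-quad+1 : ∀ a → Q (suc (quad a)) ≡ Q (suc a)
  Q-quad+1 a = trans (recurrence (suc (quad a)))
    (trans (cong₂ _xor_ (FourthPower.at-quad+4 Q a) (FourthPower.at-quad+3 Q a)) (xor-identityʳ _))

  Q-quad+2 : ∀ a → Q (suc (suc (quad a))) ≡ Q (suc a)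
  Q-quad+2 a = trans (recurrence (suc (suc (quad a)))) (cong₂ _xor_ (FourthPower.at-quad+5 Q a) (FourthPower.at-quad+4 Q a))

  Q-quad+3 : ∀ a → Q (suc (suc (suc (quad a)))) ≡ false
  Q-quad+3 a = trans (recurrence (suc (suc (suc (quad a))))) (cong₂ _xor_ (FourthPower.at-quad+6 Q a) (FourthPower.at-quad+5 Q a))

-- The sequence u and its gaps

data Parity : ℕ → Set where
  even : ∀ k → Parity (k + k)
  odd  : ∀ k → Parity (suc (k + k))

parity : ∀ n → Parity n
parity zero = even 0
parity (suc n) with parity n
... | even k = odd k
... | odd k = subst Parity (sym (double-suc k)) (even (suc k))

trailingOnesFuel : ℕ → ℕ → ℕ
trailingOnesFuel zero n = 0
trailingOnesFuel (suc f) n = if does (n % 2 ≟ 1) then suc (trailingOnesFuel f (n / 2)) else 0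

trailingOnesFuel-stable : ∀ f g n → n < f → n < g → trailingOnesFuel f n ≡ trailingOnesFuel g n
trailingOnesFuel-stable (suc f) (suc g) zero _ _ = refl
trailingOnesFuel-stable (suc f) (suc g) (suc n) (s≤s n<f) (s≤s n<g) =
  cong (λ z → if does (suc n % 2 ≟ 1) then suc z else 0)
       (trailingOnesFuel-stable f g (suc n / 2) (≤-<-trans (half-≤ n) n<f) (≤-<-trans (half-≤ n) n<g))

-- ν n = number of trailing 1-bits of n, i.e. the 2-adic valuation of n + 1.
ν : ℕ → ℕ
ν n = trailingOnesFuel (suc n) n

ν-even : ∀ k → ν (k + k) ≡ 0
ν-even k = cong (λ z → if does (z ≟ 1) then suc (trailingOnesFuel (k + k) ((k + k) / 2)) else 0) (double-parity k)

ν-odd : ∀ k → ν (suc (k + k)) ≡ suc (ν k)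
ν-odd k = trans (cong (λ z → if does (z ≟ 1) then suc (trailingOnesFuel (suc (k + k)) (suc (k + k) / 2)) else 0) (odd-parity k))
  (cong suc (trans (cong (trailingOnesFuel (suc (k + k))) (odd-half k))
                   (trailingOnesFuel-stable (suc (k + k)) (suc k) k (s≤s (m≤m+n k k)) ≤-refl)))

-- (2m + 1)·2^k, the numbers n + 1 with ν n = k.
oddTimesPow : ℕ → ℕ → ℕ
oddTimesPow m k = (2 * m + 1) * 2 ^ k

oddTimesPow-zero : ∀ m → oddTimesPow m 0 ≡ suc (m + m)
oddTimesPow-zero = expanded
  where
    expanded : ∀ m → (2 * m + 1) * 1 ≡ suc (m + m)
    expanded = solve-∀

oddTimesPow-suc : ∀ m k → oddTimesPow m (suc k) ≡ oddTimesPow m k + oddTimesPow m k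
oddTimesPow-suc m k = expanded m (2 ^ k)
  where
    expanded : ∀ m y → (2 * m + 1) * (2 * y) ≡ (2 * m + 1) * y + (2 * m + 1) * y
    expanded = solve-∀

oddTimesPow-positive : ∀ m k → ∃ λ r → oddTimesPow m k ≡ suc r
oddTimesPow-positive m zero = m + m , oddTimesPow-zero m
oddTimesPow-positive m (suc k) with oddTimesPow-positive m k
... | r , e = r + suc r , trans (oddTimesPow-suc m k) (cong (λ z → z + z) e)

ν-characterisation⇒ : ∀ k n → ν n ≡ k → ∃ λ m → suc n ≡ oddTimesPow m k
ν-characterisation⇒ k n ν≡k with parity n
ν-characterisation⇒ k .(j + j) ν≡k | even j =
  j , subst (λ k → suc (j + j) ≡ oddTimesPow j k) (trans (sym (ν-even j)) ν≡k) (sym (oddTimesPow-zero j))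
ν-characterisation⇒ zero .(suc (j + j)) ν≡k | odd j with trans (sym (ν-odd j)) ν≡k
... | ()
ν-characterisation⇒ (suc k) .(suc (j + j)) ν≡k | odd j with ν-characterisation⇒ k j (suc-injective (trans (sym (ν-odd j)) ν≡k))
... | m , e = m , trans (double-suc j) (trans (cong (λ z → z + z) e) (sym (oddTimesPow-suc m k)))

ν-characterisation⇐ : ∀ k n m → suc n ≡ oddTimesPow m k → ν n ≡ k
ν-characterisation⇐ zero n m e = trans (cong ν (suc-injective (trans e (oddTimesPow-zero m)))) (ν-even m)
ν-characterisation⇐ (suc k) n m e with oddTimesPow-positive m k
... | r , er = trans (cong ν n≡) (trans (ν-odd r) (cong suc (ν-characterisation⇐ k r m (sym er))))
  where
    n≡ : n ≡ suc (r + r)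
    n≡ = suc-injective (trans e (trans (oddTimesPow-suc m k) (trans (cong (λ z → z + z) er) (sym (double-suc r)))))

-- g(k) − 1 where g(k) = (1 + 2·4^k)/3, via g(k+1) − 1 = 4(g(k) − 1) + 2.
gapPred : ℕ → ℕ
gapPred zero = 0
gapPred (suc k) = 2 + 4 * gapPred k

gapPred-injective : ∀ a b → gapPred a ≡ gapPred b → a ≡ b
gapPred-injective zero zero e = refl
gapPred-injective (suc a) (suc b) e =
  cong suc (gapPred-injective a b (*-cancelˡ-≡ (gapPred a) (gapPred b) 4 (suc-injective (suc-injective e))))

gapValue≡ : ∀ k → gapValue k ≡ suc (gapPred k)
gapValue≡ k = trans (cong (_/ 3) (threeTimes k)) (m*n/n≡m (suc (gapPred k)) 3)
  where
    step₁ : ∀ x → (1 + 2 * (4 * x)) + 3 ≡ 4 * (1 + 2 * x)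
    step₁ = solve-∀
    step₂ : ∀ g → 4 * (suc g * 3) ≡ suc (2 + 4 * g) * 3 + 3
    step₂ = solve-∀
    threeTimes : ∀ k → 1 + 2 * 4 ^ k ≡ suc (gapPred k) * 3
    threeTimes zero = refl
    threeTimes (suc k) = +-cancelʳ-≡ 3 _ _ (trans (step₁ (4 ^ k)) (trans (cong (4 *_) (threeTimes k)) (step₂ (gapPred k))))

-- v n = u n − 1 = Σ_{i<n} g(ν i).
v : ℕ → ℕ
v zero = 0
v (suc n) = v n + suc (gapPred (ν n))

u : ℕ → ℕ
u n = suc (v n)

u-increasing : ∀ n → u n < u (suc n)
u-increasing n = s≤s (m<m+n (v n) (s≤s z≤n))

u-gap : ∀ n → u (suc n) ∸ u n ≡ suc (gapPred (ν n))
u-gap n = m+n∸m≡n (v n) (suc (gapPred (ν n)))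

v-double : ∀ k → v (k + k) ≡ quad (v k) × v (suc (k + k)) ≡ suc (quad (v k))
v-double zero = refl , refl
v-double (suc j) = v-even , trans (cong (λ z → z + suc (gapPred (ν (suc j + suc j)))) v-even)
                                 (trans (cong (λ z → quad (v (suc j)) + suc (gapPred z)) (ν-even (suc j))) (+-comm _ 1))
  where
    step : ∀ x g → suc (x + x + (x + x)) + suc (2 + 4 * g) ≡ (x + suc g) + (x + suc g) + ((x + suc g) + (x + suc g))
    step = solve-∀
    v-even : v (suc j + suc j) ≡ quad (v (suc j))
    v-even = trans (cong v (sym (double-suc j)))
      (trans (cong₂ (λ a b → a + suc (gapPred b)) (proj₂ (v-double j)) (ν-odd j)) (step (v j) (gapPred (ν j))))

u-gap-characterisation : ∀ k n → (u (suc n) ∸ u n ≡ gapValue k) ⇔ ∃ λ m → n ≡ (2 * m + 1) * 2 ^ k ∸ 1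
u-gap-characterisation k n = mk⇔ to from
  where
    to : u (suc n) ∸ u n ≡ gapValue k → ∃ λ m → n ≡ (2 * m + 1) * 2 ^ k ∸ 1
    to e with ν-characterisation⇒ k n (gapPred-injective _ _ (suc-injective (trans (sym (u-gap n)) (trans e (gapValue≡ k)))))
    ... | m , e' = m , cong (_∸ 1) e'
    from : (∃ λ m → n ≡ (2 * m + 1) * 2 ^ k ∸ 1) → u (suc n) ∸ u n ≡ gapValue k
    from (m , e) with oddTimesPow-positive m k
    ... | r , er = trans (u-gap n)
      (trans (cong (λ z → suc (gapPred z)) (ν-characterisation⇐ k n m (trans (cong suc (trans e (cong (_∸ 1) er))) (sym er))))
             (sym (gapValue≡ k)))

-- The support of Q is the set of values of u

module Support (Q : Series) (Q0 : Q 0 ≡ false) (D∘Q≈X : ∀ n → compS D Q n ≡ XS n) where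

  open InverseCoefficients Q Q0 D∘Q≈X

  -- By strong induction: u(2k) = 4(u k − 1) + 1 and u(2k+1) = 4(u k − 1) + 2.
  Q-on-u : ∀ n → Q (u n) ≡ true
  Q-on-u = <-rec (λ n → Q (u n) ≡ true) step
    where
      step : ∀ n → (∀ {m} → m < n → Q (u m) ≡ true) → Q (u n) ≡ true
      step n ih with parity n
      ... | even zero = Q-one
      ... | even (suc j) = trans (cong (λ z → Q (suc z)) (proj₁ (v-double (suc j))))
                                 (trans (Q-quad+1 (v (suc j))) (ih (m<m+n (suc j) (s≤s z≤n))))
      ... | odd j = trans (cong (λ z → Q (suc z)) (proj₂ (v-double j)))
                          (trans (Q-quad+2 (v j)) (ih (s≤s (m≤m+n j j))))

  support-in-u : ∀ m → Q m ≡ true → ∃ λ n → u n ≡ m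
  support-in-u = <-rec (λ m → Q m ≡ true → ∃ λ n → u n ≡ m) (λ m → fromResidue (residue4 m))
    where
      true≢false : true ≢ false
      true≢false ()
      fromResidue : ∀ {m} → Residue4 m → (∀ {m'} → m' < m → Q m' ≡ true → ∃ λ n → u n ≡ m') →
                    Q m ≡ true → ∃ λ n → u n ≡ m
      fromResidue (r0 a) ih Qm = ⊥-elim (true≢false (trans (sym Qm) (Q-quad a)))
      fromResidue (r3 a) ih Qm = ⊥-elim (true≢false (trans (sym Qm) (Q-quad+3 a)))
      fromResidue (r1 zero) ih Qm = 0 , refl
      fromResidue (r1 (suc j)) ih Qm = evenPosition (ih below (trans (sym (Q-quad+1 (suc j))) Qm))
        where
          below : suc (suc j) < suc (quad (suc j))
          below = s≤s (≤-trans (s≤s (m≤n+m (suc j) j)) (m≤m+n (suc j + suc j) (suc j + suc j)))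
          evenPosition : (∃ λ n → u n ≡ suc (suc j)) → ∃ λ n → u n ≡ suc (quad (suc j))
          evenPosition (n , un≡) = n + n , cong suc (trans (proj₁ (v-double n)) (cong quad (suc-injective un≡)))
      fromResidue (r2 a) ih Qm = oddPosition (ih below (trans (sym (Q-quad+2 a)) Qm))
        where
          below : suc a < suc (suc (quad a))
          below = s≤s (s≤s (≤-trans (m≤m+n a a) (m≤m+n (a + a) (a + a))))
          oddPosition : (∃ λ n → u n ≡ suc a) → ∃ λ n → u n ≡ suc (suc (quad a))
          oddPosition (n , un≡) = suc (n + n) , cong suc (trans (proj₂ (v-double n)) (cong (λ z → suc (quad z)) (suc-injective un≡)))

  support≡values-of-u : ∀ m → (Q m ≡ true) ⇔ ∃ λ n → u n ≡ m
  support≡values-of-u m = mk⇔ (support-in-u m) (λ { (n , refl) → Q-on-u n })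

mainTheorem10 : (Q : Series) → Q 0 ≡ false
    → (∀ n → compS D Q n ≡ XS n) → (∀ n → compS Q D n ≡ XS n)
    → Σ (ℕ → ℕ) λ u →
        (∀ n → u n < u (suc n))
        × (∀ m → (Q m ≡ true) ⇔ ∃ λ n → u n ≡ m)
        × (∀ n → ∃ λ k → u (suc n) ∸ u n ≡ gapValue k)
        × (∀ k → ∃ λ n → u (suc n) ∸ u n ≡ gapValue k)
        × (∀ k n → (u (suc n) ∸ u n ≡ gapValue k) ⇔ ∃ λ m → n ≡ (2 * m + 1) * 2 ^ k ∸ 1)
mainTheorem10 Q Q0 D∘Q≈X _ =
  u , u-increasing , Support.support≡values-of-u Q Q0 D∘Q≈X , every-gap-is-a-gapValue , every-gapValue-occurs ,
  u-gap-characterisation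
  where
    every-gap-is-a-gapValue : ∀ n → ∃ λ k → u (suc n) ∸ u n ≡ gapValue k
    every-gap-is-a-gapValue n = ν n , trans (u-gap n) (sym (gapValue≡ (ν n)))
    -- the gap g(k) occurs after position 2^k − 1 (take m = 0)
    every-gapValue-occurs : ∀ k → ∃ λ n → u (suc n) ∸ u n ≡ gapValue k
    every-gapValue-occurs k with oddTimesPow-positive 0 k
    ... | r , er = r , Equivalence.from (u-gap-characterisation k r) (0 , cong (_∸ 1) (sym er))
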